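{- Let $d \ge 1$ and $1 \le r \le d$ be integers and let $k = \gcd(d, r)$. There exists a $d$-regular generalized graph $G$ on $(d+r)/k$ vertices with an independent exact $r$-cover, with the following additional property: if $d$ is even, then $G$ has no semi-edge; if $d$ is odd, then $G$ has a 1-factor $M$ such that every semi-edge of $G$ is in $M$.
   Context: A generalized graph consists of a set $V$ of vertices and a set $D$ of darts; each dart is incident to exactly one vertex, and the darts are partitioned into pairs and singletons. Two paired darts incident to distinct vertices form an ordinary edge; two distinct paired darts at the same vertex form a loop; an unpaired dart is a semi-edge. Multiple edges, loops and semi-edges are allowed. The degree of a vertex is the number of darts incident to it (loop counts 2, semi-edge 1). A 1-factor is a set of edges (ordinary edges and semi-edges) such that every vertex is incident to exactly one dart in it. A vertex subset $S$ is independent if no vertex of $S$ is incident to a loop or a semi-edge and there is no ordinary edge between two vertices of $S$; $S$ is an exact $r$-cover if every vertex outside $S$ is incident to exactly $r$ ordinary edges with other endpoint in $S$ (counted with multiplicity). An independent exact $r$-cover is a set that is both. -}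

module Defs where

open import Data.Nat using (ℕ)
open import Data.Fin using (Fin; _≟_)
open import Data.Fin.Subset using (Subset; _∈_; _∉_)
open import Data.Fin.Subset.Properties using (_∈?_)
open import Data.List using (length; filter)
open import Data.List using (List)
import Data.List.Base
open import Data.Product using (Σ; _×_; _,_)
open import Relation.Nullary using (¬_; Dec)
open import Relation.Nullary.Decidable using (¬?; _×-dec_)
open import Relation.Unary using (Pred; Decidable)
open import Relation.Binary.PropositionalEquality using (_≡_; _≢_)
open import Level using (0ℓ)

allFin : (m : ℕ) → List (Fin m)
allFin m = Data.List.Base.allFin m

count : {m : ℕ} {P : Pred (Fin m) 0ℓ} → Decidable P → ℕ
count {m} P? = length (filter P? (allFin m))

-- A finite generalized graph: vertices Fin nV, darts Fin nD,
-- each dart incident to exactly one vertex (inc), and the partition of darts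
-- into pairs and singletons is given by an involution pair:
-- pair x ≢ x means {x , pair x} is a pair, pair x ≡ x means {x} is a singleton.
record GGraph : Set where
  field
    nV    : ℕ
    nD    : ℕ
    inc   : Fin nD → Fin nV
    pair  : Fin nD → Fin nD
    invol : ∀ x → pair (pair x) ≡ x

module _ (G : GGraph) where
  open GGraph G

  IsSemiEdge : Fin nD → Set
  IsSemiEdge x = pair x ≡ x

  IsLoopDart : Fin nD → Set
  IsLoopDart x = pair x ≢ x × inc (pair x) ≡ inc x

  IsOrdDart : Fin nD → Set
  IsOrdDart x = pair x ≢ x × inc (pair x) ≢ inc x

  degree : Fin nV → ℕ
  degree v = count (λ x → inc x ≟ v)

  Regular : ℕ → Set
  Regular d = ∀ v → degree v ≡ d

  HasNoSemiEdge : Set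
  HasNoSemiEdge = ∀ x → ¬ IsSemiEdge x

  -- A set of edges, represented by the set of their darts (closed under pairing)
  -- consisting of ordinary edges and semi-edges, such that every vertex is
  -- incident to exactly one dart in it.
  record OneFactor : Set where
    field
      darts      : Subset nD
      closed     : ∀ x → x ∈ darts → pair x ∈ darts
      noLoop     : ∀ x → x ∈ darts → ¬ IsLoopDart x
      exactlyOne : ∀ v → count (λ x → (inc x ≟ v) ×-dec (x ∈? darts)) ≡ 1

  Independent : Subset nV → Set
  Independent S =
    (∀ x → inc x ∈ S → ¬ IsSemiEdge x × ¬ IsLoopDart x) ×
    (∀ x → IsOrdDart x → inc x ∈ S → inc (pair x) ∉ S)

  -- every vertex outside S is incident to exactly r ordinary edges whose other
  -- endpoint lies in S (counted with multiplicity, via darts at v)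
  ExactCover : ℕ → Subset nV → Set
  ExactCover r S = ∀ v → v ∉ S →
    count (λ x → (inc x ≟ v) ×-dec
                 ((¬? (pair x ≟ x) ×-dec ¬? (inc (pair x) ≟ inc x)) ×-dec
                  (inc (pair x) ∈? S))) ≡ r

{-# OPTIONS --safe #-}
module Submission where

-- Write d = a k and r = b k with a = b + m. Take a set S of b vertices and a set T of a vertices and
-- join every vertex of S to every vertex of T by k parallel edges: S is independent, its vertices have
-- degree a k = d, and every vertex of T has exactly b k = r edges into S. The remaining m k darts at
-- each t ∈ T are paired by twisting an involution π of T: if π t ≠ t, dart ℓ at t is paired with dart
-- ℓ at π t; if π t = t, it is paired with dart m k - 1 - ℓ at t, which yields loops and, exactly when
-- m k is odd, one semi-edge. Since reversing a set of even size has no fixed point, π can be chosen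
-- according to the parities of d and m k so that there are no semi-edges when d is even, while for odd
-- d the 1-factor matches the i-th vertex of S with the i-th vertex of T and uses, at each of the other
-- m vertices of T, either its semi-edge or an edge to its π-partner.

open import Algebra.Definitions using (Involutive)
open import Data.Bool.Base using (if_then_else_)
open import Data.Empty using (⊥)
open import Data.Fin.Base
  using (Fin; zero; suc; toℕ; _↑ˡ_; _↑ʳ_; splitAt; join; combine; remQuot; opposite; fromℕ<)
open import Data.Fin.Properties
  using ( _≟_; splitAt-↑ˡ; splitAt-↑ʳ; splitAt-join; join-splitAt; remQuot-combine; combine-remQuot
        ; ↑ˡ-injective; ↑ʳ-injective; toℕ<n; toℕ-injective; toℕ-fromℕ<; opposite-prop
        ; opposite-involutive)
  renaming (suc-injective to Fin-suc-injective)
open import Data.Fin.Subset using (Subset; _∈_; _∉_; inside; outside)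
open import Data.Fin.Subset.Properties using (_∈?_)
import Data.List.Base as List
open import Data.Nat.Base using (ℕ; zero; suc; _+_; _*_; _∸_; _≤_; _<_; s≤s; NonZero; ≢-nonZero)
open import Data.Nat.Divisibility using (_∣_; _∣?_; divides; ∣m⇒∣m*n; ∣n⇒∣m*n)
open import Data.Nat.GCD using (gcd; gcd[m,n]∣m; gcd[m,n]∣n; gcd[m,n]≢0)
open import Data.Nat.Primality using (Prime; prime?; euclidsLemma)
open import Data.Nat.Properties
  using ( +-0-commutativeMonoid; +-assoc; +-identityʳ; *-identityʳ; *-comm; *-distribʳ-+
        ; *-cancelˡ-≡; *-cancelʳ-≤; suc-injective; m<n⇒n≢0; m+[n∸m]≡n; m+n∸m≡n; m≤m+n; even≢odd)
open import Algebra.Properties.CommutativeMonoid.Sum +-0-commutativeMonoid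
  using (sum-syntax; sum-cong-≗; sum-replicate-zero)
open import Data.Nat.Tactic.RingSolver using (solve-∀)
open import Data.Product using (∃!)
open import Data.Product.Base using (Σ; ∃-syntax; _×_; _,_; proj₁; proj₂; uncurry)
open import Data.Sum.Base as Sum using (_⊎_; inj₁; inj₂)
open import Data.Sum.Properties using (≡-dec; inj₁-injective; inj₂-injective; map-map; map-cong; map-id)
open import Data.Unit.Base using (tt)
open import Data.Vec.Base using (tabulate; replicate; _++_)
open import Data.Vec.Properties
  using (lookup∘tabulate; []=⇒lookup; lookup⇒[]=; lookup-++ˡ; lookup-++ʳ; lookup-replicate)
open import Defs
open import Function.Base using (id; _∘_)
open import Level using (0ℓ)
open import Relation.Binary.Definitions using (DecidableEquality)
open import Relation.Binary.PropositionalEquality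
  using (_≡_; _≢_; refl; sym; trans; cong; cong₂; subst; module ≡-Reasoning)
open import Relation.Nullary using (¬_; Dec; yes; no; does; contradiction)
open import Relation.Nullary.Decidable using (_×-dec_; ¬?; dec-true; from-yes; decidable-stable)
open import Relation.Unary using (Pred; Decidable)

indicator : {P : Set} → Dec P → ℕ
indicator (yes _) = 1
indicator (no _)  = 0

indicator-yes : {P : Set} (p : Dec P) → P → indicator p ≡ 1
indicator-yes (yes _) _ = refl
indicator-yes (no ¬p) p = contradiction p ¬p

indicator-no : {P : Set} (p : Dec P) → ¬ P → indicator p ≡ 0
indicator-no (yes p) ¬p = contradiction p ¬p
indicator-no (no _)  _  = refl

indicator-cong : {P Q : Set} (p : Dec P) (q : Dec Q) → (P → Q) → (Q → P) → indicator p ≡ indicator q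
indicator-cong (yes p) q f _ = sym (indicator-yes q (f p))
indicator-cong (no ¬p) q _ g = sym (indicator-no q (¬p ∘ g))

∑-zero : ∀ {n} (f : Fin n → ℕ) → (∀ i → f i ≡ 0) → ∑[ i < n ] f i ≡ 0
∑-zero {n} f f≡0 = trans (sum-cong-≗ f≡0) (sum-replicate-zero n)

∑-const : ∀ n c → ∑[ i < n ] c ≡ n * c
∑-const zero    c = refl
∑-const (suc n) c = cong (c +_) (∑-const n c)

∑-single : ∀ {n} (f : Fin n → ℕ) j → (∀ i → i ≢ j → f i ≡ 0) → ∑[ i < n ] f i ≡ f j
∑-single f zero    off =
  trans (cong (f zero +_) (∑-zero (f ∘ suc) λ i → off (suc i) λ ())) (+-identityʳ (f zero))
∑-single f (suc j) off =
  cong₂ _+_ (off zero λ ()) (∑-single (f ∘ suc) j λ i i≢j → off (suc i) (i≢j ∘ Fin-suc-injective))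

∑-↑ : ∀ p q (f : Fin (p + q) → ℕ) → ∑[ i < p + q ] f i ≡ ∑[ i < p ] f (i ↑ˡ q) + ∑[ j < q ] f (p ↑ʳ j)
∑-↑ zero    q f = refl
∑-↑ (suc p) q f = trans (cong (f zero +_) (∑-↑ p q (f ∘ suc))) (sym (+-assoc (f zero) _ _))

∑-combine : ∀ p q (f : Fin (p * q) → ℕ) → ∑[ i < p * q ] f i ≡ ∑[ i < p ] ∑[ j < q ] f (combine i j)
∑-combine zero    q f = refl
∑-combine (suc p) q f =
  trans (∑-↑ q (p * q) f) (cong (∑[ j < q ] f (j ↑ˡ p * q) +_) (∑-combine p q (f ∘ (q ↑ʳ_))))

length-filter-tabulate : ∀ {A : Set} {P : Pred A 0ℓ} (P? : Decidable P) {n} (f : Fin n → A) →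
  List.length (List.filter P? (List.tabulate f)) ≡ ∑[ i < n ] indicator (P? (f i))
length-filter-tabulate P? {zero}  f = refl
length-filter-tabulate P? {suc n} f with P? (f zero)
... | yes _ = cong suc (length-filter-tabulate P? (f ∘ suc))
... | no  _ = length-filter-tabulate P? (f ∘ suc)

count≡∑ : ∀ {n} {P : Pred (Fin n) 0ℓ} (P? : Decidable P) → count P? ≡ ∑[ i < n ] indicator (P? i)
count≡∑ P? = length-filter-tabulate P? id

count-cong : ∀ {n} {P Q : Pred (Fin n) 0ℓ} (P? : Decidable P) (Q? : Decidable Q) →
  (∀ i → P i → Q i) → (∀ i → Q i → P i) → count P? ≡ count Q?
count-cong P? Q? P⇒Q Q⇒P = begin
  count P?                     ≡⟨ count≡∑ P? ⟩
  ∑[ i < _ ] indicator (P? i)  ≡⟨ sum-cong-≗ (λ i → indicator-cong (P? i) (Q? i) (P⇒Q i) (Q⇒P i)) ⟩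
  ∑[ i < _ ] indicator (Q? i)  ≡⟨ count≡∑ Q? ⟨
  count Q?                     ∎
  where open ≡-Reasoning

count-unique : ∀ {n} {P : Pred (Fin n) 0ℓ} (P? : Decidable P) j → P j → (∀ i → P i → i ≡ j) →
  count P? ≡ 1
count-unique P? j Pj unique = begin
  count P?                     ≡⟨ count≡∑ P? ⟩
  ∑[ i < _ ] indicator (P? i)  ≡⟨ ∑-single _ j (λ i i≢j → indicator-no (P? i) (i≢j ∘ unique i)) ⟩
  indicator (P? j)             ≡⟨ indicator-yes (P? j) Pj ⟩
  1                            ∎
  where open ≡-Reasoning

∈-tabulate⁺ : ∀ {n} {P : Pred (Fin n) 0ℓ} (P? : Decidable P) {i} → P i → i ∈ tabulate (does ∘ P?)
∈-tabulate⁺ P? {i} Pi = lookup⇒[]= i _ (trans (lookup∘tabulate (does ∘ P?) i) (dec-true (P? i) Pi))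

∈-tabulate⁻ : ∀ {n} {P : Pred (Fin n) 0ℓ} (P? : Decidable P) {i} → i ∈ tabulate (does ∘ P?) → P i
∈-tabulate⁻ P? {i} i∈ with P? i | trans (sym (lookup∘tabulate (does ∘ P?) i)) ([]=⇒lookup i∈)
... | yes Pi | _  = Pi
... | no _   | ()

1+2*⇒odd : ∀ p → ¬ 2 ∣ suc (2 * p)
1+2*⇒odd p (divides q eq) = even≢odd q p (trans (*-comm 2 q) (sym eq))

even-or-odd : ∀ n → 2 ∣ n ⊎ ∃[ p ] n ≡ suc (2 * p)
even-or-odd zero    = inj₁ (divides 0 refl)
even-or-odd (suc n) with even-or-odd n
... | inj₁ (divides p refl) = inj₂ (p , cong suc (*-comm p 2))
... | inj₂ (p , refl)       = inj₁ (divides (suc p) (cong (2 +_) (*-comm 2 p)))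

odd⇒1+2* : ∀ {n} → ¬ 2 ∣ n → ∃[ p ] n ≡ suc (2 * p)
odd⇒1+2* {n} odd with even-or-odd n
... | inj₁ even = contradiction even odd
... | inj₂ half = half

odd+odd⇒even : ∀ {x y} → ¬ 2 ∣ x → ¬ 2 ∣ y → 2 ∣ x + y
odd+odd⇒even oddx oddy with odd⇒1+2* oddx | odd⇒1+2* oddy
... | p , refl | q , refl = divides (suc (p + q)) (sum-of-odds p q)
  where
  sum-of-odds : ∀ p q → suc (2 * p) + suc (2 * q) ≡ suc (p + q) * 2
  sum-of-odds = solve-∀

odd⇒Fin : ∀ {n} → ¬ 2 ∣ n → Fin n
odd⇒Fin {zero}  odd = contradiction (divides 0 refl) odd
odd⇒Fin {suc _} _   = zero

least : ∀ {n} → Fin n → Fin n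
least {suc _} _ = zero

least-constant : ∀ {n} (i j : Fin n) → least i ≡ least j
least-constant {suc _} _ _ = refl

module _ {n : ℕ} where

  opposite-fixed⇒odd : ∀ {i : Fin n} → opposite i ≡ i → n ≡ suc (2 * toℕ i)
  opposite-fixed⇒odd {i} fixed = begin
    n                                ≡⟨ m+[n∸m]≡n (toℕ<n i) ⟨
    suc (toℕ i) + (n ∸ suc (toℕ i))  ≡⟨ cong (suc (toℕ i) +_) (opposite-prop i) ⟨
    suc (toℕ i) + toℕ (opposite i)   ≡⟨ cong (λ x → suc (toℕ i + toℕ x)) fixed ⟩
    suc (toℕ i + toℕ i)              ≡⟨ cong (λ x → suc (toℕ i + x)) (+-identityʳ (toℕ i)) ⟨
    suc (2 * toℕ i)                  ∎
    where open ≡-Reasoning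

  even⇒opposite-fixpointFree : 2 ∣ n → ∀ (i : Fin n) → opposite i ≢ i
  even⇒opposite-fixpointFree even i fixed = 1+2*⇒odd (toℕ i) (subst (2 ∣_) (opposite-fixed⇒odd fixed) even)

  opposite-fixed-unique : ∀ {i j : Fin n} → opposite i ≡ i → opposite j ≡ j → i ≡ j
  opposite-fixed-unique {i} {j} fixedᵢ fixedⱼ = toℕ-injective (*-cancelˡ-≡ (toℕ i) (toℕ j) 2
    (suc-injective (trans (sym (opposite-fixed⇒odd fixedᵢ)) (opposite-fixed⇒odd fixedⱼ))))

  odd⇒opposite-fixed : ¬ 2 ∣ n → Σ (Fin n) λ i → opposite i ≡ i
  odd⇒opposite-fixed odd with odd⇒1+2* odd
  ... | p , refl = middle , toℕ-injective (begin
    toℕ (opposite middle)  ≡⟨ opposite-prop middle ⟩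
    2 * p ∸ toℕ middle     ≡⟨ cong (2 * p ∸_) (toℕ-fromℕ< p<n) ⟩
    p + (p + 0) ∸ p        ≡⟨ m+n∸m≡n p (p + 0) ⟩
    p + 0                  ≡⟨ +-identityʳ p ⟩
    p                      ≡⟨ toℕ-fromℕ< p<n ⟨
    toℕ middle             ∎)
    where
    open ≡-Reasoning
    p<n : p < suc (2 * p)
    p<n = s≤s (m≤m+n p (p + 0))
    middle : Fin (suc (2 * p))
    middle = fromℕ< p<n

map-involutive : ∀ {A B : Set} {f : A → A} {g : B → B} →
  Involutive _≡_ f → Involutive _≡_ g → Involutive _≡_ (Sum.map f g)
map-involutive f-involutive g-involutive x =
  trans (map-map x) (trans (map-cong f-involutive g-involutive x) (map-id x))

module Twist {T : Set} (_≟ᵀ_ : DecidableEquality T) (π : T → T) {n : ℕ} where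

  twist : T × Fin n → T × Fin n
  twist (t , ℓ) = if does (π t ≟ᵀ t) then (t , opposite ℓ) else (π t , ℓ)

  twist-stay : ∀ {t ℓ} → π t ≡ t → twist (t , ℓ) ≡ (t , opposite ℓ)
  twist-stay {t} fixed with π t ≟ᵀ t
  ... | yes _     = refl
  ... | no  moved = contradiction fixed moved

  twist-move : ∀ {t ℓ} → π t ≢ t → twist (t , ℓ) ≡ (π t , ℓ)
  twist-move {t} moved with π t ≟ᵀ t
  ... | yes fixed = contradiction fixed moved
  ... | no  _     = refl

  twist-involutive : Involutive _≡_ π → Involutive _≡_ twist
  twist-involutive π-involutive (t , ℓ) with π t ≟ᵀ t
  ... | yes fixed = trans (twist-stay fixed) (cong (t ,_) (opposite-involutive ℓ))
  ... | no  moved = trans (twist-move (λ fixed → moved (trans (sym fixed) (π-involutive t))))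
                          (cong (_, ℓ) (π-involutive t))

  twist-fixed : ∀ {t ℓ} → twist (t , ℓ) ≡ (t , ℓ) → π t ≡ t × opposite ℓ ≡ ℓ
  twist-fixed {t} fixed with π t ≟ᵀ t
  ... | yes πt≡t  = πt≡t , cong proj₂ fixed
  ... | no  moved = contradiction (cong proj₁ fixed) moved

module _ (G : GGraph) where
  open GGraph G

  dartsLeave⇒Independent : ∀ {S} → (∀ x → inc x ∈ S → inc (pair x) ∉ S) → Independent G S
  dartsLeave⇒Independent {S} leave =
    (λ x x∈S → (λ semi → leave x x∈S (subst (_∈ S) (sym (cong inc semi)) x∈S))
             , (λ loop → leave x x∈S (subst (_∈ S) (sym (proj₂ loop)) x∈S)))
    , (λ x _ x∈S → leave x x∈S)

  -- A dart from outside S into S is automatically an ordinary dart.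
  countIntoS⇒ExactCover : ∀ {r S} →
    (∀ v → v ∉ S → count (λ x → (inc x ≟ v) ×-dec (inc (pair x) ∈? S)) ≡ r) → ExactCover G r S
  countIntoS⇒ExactCover {S = S} counts v v∉S =
    trans (count-cong (λ x → (inc x ≟ v) ×-dec (ordinary? x ×-dec (inc (pair x) ∈? S)))
                      (λ x → (inc x ≟ v) ×-dec (inc (pair x) ∈? S))
                      (λ _ (at , _ , into) → at , into)
                      (λ x (at , into) → at , ordinary x at into , into))
          (counts v v∉S)
    where
    ordinary? : ∀ x → Dec (IsOrdDart G x)
    ordinary? x = ¬? (pair x ≟ x) ×-dec ¬? (inc (pair x) ≟ inc x)
    ordinary : ∀ x → inc x ≡ v → inc (pair x) ∈ S → IsOrdDart G x
    ordinary x refl into = (λ semi → v∉S (subst (_∈ S) (cong inc semi) into))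
                         , (λ same → v∉S (subst (_∈ S) same into))

-- The generalized graph whose darts are those of Dart, the dart `dart v i` being numbered combine v i.
module DartGraph {Dart : Set} (n δ : ℕ)
  (vertex : Dart → Fin n) (slot : Dart → Fin δ) (dart : Fin n → Fin δ → Dart)
  (vertex-dart : ∀ v i → vertex (dart v i) ≡ v)
  (slot-dart : ∀ v i → slot (dart v i) ≡ i)
  (dart-vertex-slot : ∀ x → dart (vertex x) (slot x) ≡ x)
  (partner : Dart → Dart) (partner-involutive : Involutive _≡_ partner)
  where

  code : Dart → Fin (n * δ)
  code x = combine (vertex x) (slot x)

  decode : Fin (n * δ) → Dart
  decode y = uncurry dart (remQuot {n} δ y)

  decode-combine : ∀ v i → decode (combine v i) ≡ dart v i
  decode-combine v i = cong (uncurry dart) (remQuot-combine v i)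

  decode-code : ∀ x → decode (code x) ≡ x
  decode-code x = trans (decode-combine (vertex x) (slot x)) (dart-vertex-slot x)

  code-decode : ∀ y → code (decode y) ≡ y
  code-decode y = trans (cong₂ combine (vertex-dart v i) (slot-dart v i)) (combine-remQuot {n} δ y)
    where
    v = proj₁ (remQuot {n} δ y)
    i = proj₂ (remQuot {n} δ y)

  graph : GGraph
  graph = record
    { nV    = n
    ; nD    = n * δ
    ; inc   = vertex ∘ decode
    ; pair  = code ∘ partner ∘ decode
    ; invol = λ y → trans (cong (code ∘ partner) (decode-code _))
                          (trans (cong code (partner-involutive _)) (code-decode y))
    }

  open GGraph graph using (inc; pair)

  decode-pair : ∀ y → decode (pair y) ≡ partner (decode y)
  decode-pair y = decode-code (partner (decode y))

  inc-combine : ∀ v i → inc (combine v i) ≡ v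
  inc-combine v i = trans (cong vertex (decode-combine v i)) (vertex-dart v i)

  count-at : ∀ v {Q : Pred (Fin (n * δ)) 0ℓ} (Q? : Decidable Q) →
    count (λ y → (inc y ≟ v) ×-dec Q? y) ≡ ∑[ i < δ ] indicator (Q? (combine v i))
  count-at v Q? = begin
    count (λ y → (inc y ≟ v) ×-dec Q? y)
      ≡⟨ count≡∑ (λ y → (inc y ≟ v) ×-dec Q? y) ⟩
    ∑[ y < n * δ ] indicator ((inc y ≟ v) ×-dec Q? y)
      ≡⟨ ∑-combine n δ _ ⟩
    ∑[ u < n ] ∑[ i < δ ] summand u i
      ≡⟨ ∑-single _ v (λ u u≢v → ∑-zero (summand u) λ i →
           indicator-no _ λ (at , _) → u≢v (trans (sym (inc-combine u i)) at)) ⟩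
    ∑[ i < δ ] summand v i
      ≡⟨ sum-cong-≗ (λ i → indicator-cong _ _ proj₂ (inc-combine v i ,_)) ⟩
    ∑[ i < δ ] indicator (Q? (combine v i))
      ∎
    where
    open ≡-Reasoning
    summand : Fin n → Fin δ → ℕ
    summand u i = indicator ((inc (combine u i) ≟ v) ×-dec Q? (combine u i))

  regular : Regular graph δ
  regular v = begin
    count (λ y → inc y ≟ v)                 ≡⟨ count-cong (λ y → inc y ≟ v) _ (λ _ → _, tt) (λ _ → proj₁) ⟩
    count (λ y → (inc y ≟ v) ×-dec yes tt)  ≡⟨ count-at v (λ _ → yes tt) ⟩
    ∑[ i < δ ] 1                            ≡⟨ ∑-const δ 1 ⟩
    δ * 1                                   ≡⟨ *-identityʳ δ ⟩
    δ                                       ∎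
    where open ≡-Reasoning

  independent : ∀ {S} → (∀ x → vertex x ∈ S → vertex (partner x) ∉ S) → Independent graph S
  independent {S} leave = dartsLeave⇒Independent graph λ y y∈S →
    subst (_∉ S) (sym (cong vertex (decode-pair y))) (leave (decode y) y∈S)

  exactCover : ∀ {r S} → (∀ v → v ∉ S → ∑[ i < δ ] indicator (vertex (partner (dart v i)) ∈? S) ≡ r) →
    ExactCover graph r S
  exactCover {S = S} counts = countIntoS⇒ExactCover graph λ v v∉S →
    trans (count-at v (λ y → inc (pair y) ∈? S))
          (trans (sum-cong-≗ λ i → cong (λ x → indicator (vertex x ∈? S)) (decode-pair-combine v i))
                 (counts v v∉S))
    where
    decode-pair-combine : ∀ v i → decode (pair (combine v i)) ≡ partner (dart v i)
    decode-pair-combine v i = trans (decode-pair (combine v i)) (cong partner (decode-combine v i))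

  noSemiEdge : (∀ x → partner x ≢ x) → HasNoSemiEdge graph
  noSemiEdge fixpointFree y semi = fixpointFree (decode y) (trans (sym (decode-pair y)) (cong decode semi))

  module _ {Matched : Dart → Set} (Matched? : ∀ x → Dec (Matched x))
    (partner-matched : ∀ x → Matched x → Matched (partner x))
    (matched-loopless : ∀ x → Matched x → vertex (partner x) ≡ vertex x → partner x ≡ x)
    (matched-unique : ∀ v → ∃! _≡_ λ x → vertex x ≡ v × Matched x)
    where

    matching : Subset (n * δ)
    matching = tabulate (does ∘ Matched? ∘ decode)

    ∈matching⁺ : ∀ y → Matched (decode y) → y ∈ matching
    ∈matching⁺ y = ∈-tabulate⁺ (Matched? ∘ decode)

    ∈matching⁻ : ∀ y → y ∈ matching → Matched (decode y)
    ∈matching⁻ y = ∈-tabulate⁻ (Matched? ∘ decode)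

    matching-closed : ∀ y → y ∈ matching → pair y ∈ matching
    matching-closed y y∈M =
      ∈matching⁺ (pair y) (subst Matched (sym (decode-pair y)) (partner-matched _ (∈matching⁻ y y∈M)))

    matching-noLoop : ∀ y → y ∈ matching → ¬ IsLoopDart graph y
    matching-noLoop y y∈M (paired , loop) = paired (begin
      code (partner (decode y))  ≡⟨ cong code (matched-loopless _ (∈matching⁻ y y∈M) same) ⟩
      code (decode y)            ≡⟨ code-decode y ⟩
      y                          ∎)
      where
      open ≡-Reasoning
      same : vertex (partner (decode y)) ≡ vertex (decode y)
      same = trans (sym (cong vertex (decode-pair y))) loop

    matching-exactlyOne : ∀ v → count (λ y → (inc y ≟ v) ×-dec (y ∈? matching)) ≡ 1
    matching-exactlyOne v with matched-unique v
    ... | x , (at , matched) , unique = count-unique (λ y → (inc y ≟ v) ×-dec (y ∈? matching)) (code x)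
      ( trans (cong vertex (decode-code x)) at
      , ∈matching⁺ (code x) (subst Matched (sym (decode-code x)) matched))
      (λ y (at′ , y∈M) → trans (sym (code-decode y)) (cong code (sym (unique (at′ , ∈matching⁻ y y∈M)))))

    oneFactor : OneFactor graph
    oneFactor = record
      { darts      = matching
      ; closed     = matching-closed
      ; noLoop     = matching-noLoop
      ; exactlyOne = matching-exactlyOne
      }

    semiEdge∈oneFactor : (∀ x → partner x ≡ x → Matched x) →
      ∀ y → IsSemiEdge graph y → y ∈ OneFactor.darts oneFactor
    semiEdge∈oneFactor fixed⇒matched y semi =
      ∈matching⁺ y (fixed⇒matched _ (trans (sym (decode-pair y)) (cong decode semi)))

CoverGraph : ℕ → ℕ → ℕ → Set
CoverGraph d r k = Σ GGraph λ G →
  (GGraph.nV G * k ≡ d + r) ×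
  Regular G d ×
  (Σ (Subset (GGraph.nV G)) λ S → Independent G S × ExactCover G r S) ×
  (2 ∣ d → HasNoSemiEdge G) ×
  (¬ (2 ∣ d) → Σ (OneFactor G) λ M → ∀ x → IsSemiEdge G x → x ∈ OneFactor.darts M)

-- The vertices are tVertex t for t in T = Fin b ⊎ Fin m, followed by sVertex σ for σ in S = Fin b.
-- up t σ c and down σ t c are the two darts of the c-th edge between t and σ; inner t ℓ are the
-- remaining m k darts at t.
module Construction (b m k : ℕ) where

  T : Set
  T = Fin b ⊎ Fin m

  _≟ᵀ_ : DecidableEquality T
  _≟ᵀ_ = ≡-dec _≟_ _≟_

  nv δ : ℕ
  nv = (b + m) + b
  δ  = (b + m) * k

  tVertex : T → Fin nv
  tVertex t = join b m t ↑ˡ b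

  sVertex : Fin b → Fin nv
  sVertex σ = (b + m) ↑ʳ σ

  S : Subset nv
  S = replicate (b + m) outside ++ replicate b inside

  tVertex∉S : ∀ t → tVertex t ∉ S
  tVertex∉S t t∈S with trans (sym ([]=⇒lookup t∈S))
                             (trans (lookup-++ˡ (replicate (b + m) outside) _ (join b m t))
                                    (lookup-replicate (join b m t) outside))
  ... | ()

  sVertex∈S : ∀ σ → sVertex σ ∈ S
  sVertex∈S σ =
    lookup⇒[]= (sVertex σ) S (trans (lookup-++ʳ (replicate (b + m) outside) _ σ) (lookup-replicate σ inside))

  tVertex≢sVertex : ∀ t σ → tVertex t ≢ sVertex σ
  tVertex≢sVertex t σ eq = tVertex∉S t (subst (_∈ S) (sym eq) (sVertex∈S σ))

  tVertex-injective : ∀ t t′ → tVertex t ≡ tVertex t′ → t ≡ t′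
  tVertex-injective t t′ eq = begin
    t                        ≡⟨ splitAt-join b m t ⟨
    splitAt b (join b m t)   ≡⟨ cong (splitAt b) (↑ˡ-injective b _ _ eq) ⟩
    splitAt b (join b m t′)  ≡⟨ splitAt-join b m t′ ⟩
    t′                       ∎
    where open ≡-Reasoning

  sVertex-injective : ∀ {σ σ′} → sVertex σ ≡ sVertex σ′ → σ ≡ σ′
  sVertex-injective = ↑ʳ-injective (b + m) _ _

  data VertexView : Fin nv → Set where
    tView : ∀ t → VertexView (tVertex t)
    sView : ∀ σ → VertexView (sVertex σ)

  vertexView : ∀ v → VertexView v
  vertexView v = subst VertexView (join-splitAt (b + m) b v) (view (splitAt (b + m) v))
    where
    view : ∀ s → VertexView (join (b + m) b s)
    view (inj₁ q) = subst (λ q → VertexView (q ↑ˡ b)) (join-splitAt b m q) (tView (splitAt b q))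
    view (inj₂ σ) = sView σ

  data Dart : Set where
    up    : T → Fin b → Fin k → Dart
    inner : T → Fin (m * k) → Dart
    down  : Fin b → T → Fin k → Dart

  inner-injective : ∀ {p t ℓ} → uncurry inner p ≡ inner t ℓ → p ≡ (t , ℓ)
  inner-injective refl = refl

  vertex : Dart → Fin nv
  vertex (up t _ _)   = tVertex t
  vertex (inner t _)  = tVertex t
  vertex (down σ _ _) = sVertex σ

  slot : Dart → Fin δ
  slot (up _ σ c)   = combine (σ ↑ˡ m) c
  slot (inner _ ℓ)  = uncurry (λ j c → combine (b ↑ʳ j) c) (remQuot {m} k ℓ)
  slot (down _ t c) = combine (join b m t) c

  tDart : T → Fin b ⊎ Fin m → Fin k → Dart
  tDart t (inj₁ σ) c = up t σ c
  tDart t (inj₂ j) c = inner t (combine j c)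

  dartAt : Fin (b + m) ⊎ Fin b → Fin (b + m) × Fin k → Dart
  dartAt (inj₁ q) (p , c) = tDart (splitAt b q) (splitAt b p) c
  dartAt (inj₂ σ) (p , c) = down σ (splitAt b p) c

  dart : Fin nv → Fin δ → Dart
  dart v i = dartAt (splitAt (b + m) v) (remQuot {b + m} k i)

  vertex-dart : ∀ v i → vertex (dart v i) ≡ v
  vertex-dart v i = trans (vertex-dartAt (splitAt (b + m) v) (remQuot {b + m} k i)) (join-splitAt (b + m) b v)
    where
    vertex-tDart : ∀ t x c → vertex (tDart t x c) ≡ tVertex t
    vertex-tDart t (inj₁ _) c = refl
    vertex-tDart t (inj₂ _) c = refl
    vertex-dartAt : ∀ s pc → vertex (dartAt s pc) ≡ join (b + m) b s
    vertex-dartAt (inj₁ q) (p , c) =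
      trans (vertex-tDart _ (splitAt b p) c) (cong (_↑ˡ b) (join-splitAt b m q))
    vertex-dartAt (inj₂ σ) (p , c) = refl

  slot-dart : ∀ v i → slot (dart v i) ≡ i
  slot-dart v i = trans (slot-dartAt (splitAt (b + m) v) (remQuot {b + m} k i)) (combine-remQuot {b + m} k i)
    where
    slot-tDart : ∀ t x c → slot (tDart t x c) ≡ combine (join b m x) c
    slot-tDart t (inj₁ σ) c = refl
    slot-tDart t (inj₂ j) c = cong (uncurry λ j c → combine (b ↑ʳ j) c) (remQuot-combine j c)
    slot-dartAt : ∀ s pc → slot (dartAt s pc) ≡ uncurry combine pc
    slot-dartAt (inj₁ q) (p , c) =
      trans (slot-tDart _ (splitAt b p) c) (cong (λ p → combine p c) (join-splitAt b m p))
    slot-dartAt (inj₂ σ) (p , c) = cong (λ p → combine p c) (join-splitAt b m p)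

  dart-tVertex : ∀ t p c → dart (tVertex t) (combine p c) ≡ tDart t (splitAt b p) c
  dart-tVertex t p c = trans (cong₂ dartAt (splitAt-↑ˡ (b + m) (join b m t) b) (remQuot-combine p c))
                             (cong (λ t → tDart t (splitAt b p) c) (splitAt-join b m t))

  dart-vertex-slot : ∀ x → dart (vertex x) (slot x) ≡ x
  dart-vertex-slot (up t σ c) =
    trans (dart-tVertex t (σ ↑ˡ m) c) (cong (λ x → tDart t x c) (splitAt-↑ˡ b σ m))
  dart-vertex-slot (inner t ℓ) =
    trans (dart-tVertex t (b ↑ʳ j) c)
          (trans (cong (λ x → tDart t x c) (splitAt-↑ʳ b m j)) (cong (inner t) (combine-remQuot {m} k ℓ)))
    where
    j = proj₁ (remQuot {m} k ℓ)
    c = proj₂ (remQuot {m} k ℓ)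
  dart-vertex-slot (down σ t c) =
    trans (cong₂ dartAt (splitAt-↑ʳ (b + m) b σ) (remQuot-combine (join b m t) c))
          (cong (λ t → down σ t c) (splitAt-join b m t))

  ∑-at-tVertex : ∀ t (g : Dart → ℕ) →
    ∑[ i < δ ] g (dart (tVertex t) i) ≡ ∑[ σ < b ] ∑[ c < k ] g (up t σ c) + ∑[ ℓ < m * k ] g (inner t ℓ)
  ∑-at-tVertex t g = begin
    ∑[ i < δ ] g (dart (tVertex t) i)
      ≡⟨ ∑-combine (b + m) k _ ⟩
    ∑[ p < b + m ] ∑[ c < k ] g (dart (tVertex t) (combine p c))
      ≡⟨ sum-cong-≗ (λ p → sum-cong-≗ λ c → cong g (dart-tVertex t p c)) ⟩
    ∑[ p < b + m ] ∑[ c < k ] g (tDart t (splitAt b p) c)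
      ≡⟨ ∑-↑ b m _ ⟩
    ∑[ σ < b ] ∑[ c < k ] g (tDart t (splitAt b (σ ↑ˡ m)) c) +
    ∑[ j < m ] ∑[ c < k ] g (tDart t (splitAt b (b ↑ʳ j)) c)
      ≡⟨ cong₂ _+_ (sum-cong-≗ λ σ → sum-cong-≗ λ c → cong (λ x → g (tDart t x c)) (splitAt-↑ˡ b σ m))
                   (sum-cong-≗ λ j → sum-cong-≗ λ c → cong (λ x → g (tDart t x c)) (splitAt-↑ʳ b m j)) ⟩
    ∑[ σ < b ] ∑[ c < k ] g (up t σ c) + ∑[ j < m ] ∑[ c < k ] g (inner t (combine j c))
      ≡⟨ cong (∑[ σ < b ] ∑[ c < k ] g (up t σ c) +_) (∑-combine m k (g ∘ inner t)) ⟨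
    ∑[ σ < b ] ∑[ c < k ] g (up t σ c) + ∑[ ℓ < m * k ] g (inner t ℓ)
      ∎
    where open ≡-Reasoning

  module Pairing (ρ : T × Fin (m * k) → T × Fin (m * k)) (ρ-involutive : Involutive _≡_ ρ) where

    partner : Dart → Dart
    partner (up t σ c)   = down σ t c
    partner (inner t ℓ)  = uncurry inner (ρ (t , ℓ))
    partner (down σ t c) = up t σ c

    partner-involutive : Involutive _≡_ partner
    partner-involutive (up t σ c)   = refl
    partner-involutive (inner t ℓ)  = cong (uncurry inner) (ρ-involutive (t , ℓ))
    partner-involutive (down σ t c) = refl

    open DartGraph nv δ vertex slot dart vertex-dart slot-dart dart-vertex-slot partner partner-involutive

    leaveS : ∀ x → vertex x ∈ S → vertex (partner x) ∉ S
    leaveS (up t _ _)   t∈S = contradiction t∈S (tVertex∉S t)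
    leaveS (inner t _)  t∈S = contradiction t∈S (tVertex∉S t)
    leaveS (down _ t _) _   = tVertex∉S t

    intoS : ∀ v → v ∉ S → ∑[ i < δ ] indicator (vertex (partner (dart v i)) ∈? S) ≡ b * k
    intoS v v∉S with vertexView v
    ... | sView σ = contradiction (sVertex∈S σ) v∉S
    ... | tView t = begin
      ∑[ i < δ ] g (dart (tVertex t) i)                                   ≡⟨ ∑-at-tVertex t g ⟩
      ∑[ σ < b ] ∑[ c < k ] g (up t σ c) + ∑[ ℓ < m * k ] g (inner t ℓ)  ≡⟨ cong₂ _+_ ups inners ⟩
      b * k + 0                                                           ≡⟨ +-identityʳ (b * k) ⟩
      b * k                                                               ∎
      where
      open ≡-Reasoning
      g : Dart → ℕ
      g x = indicator (vertex (partner x) ∈? S)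
      upsAt : ∀ σ → ∑[ c < k ] g (up t σ c) ≡ k
      upsAt σ = trans (sum-cong-≗ {k} λ _ → indicator-yes (sVertex σ ∈? S) (sVertex∈S σ))
                      (trans (∑-const k 1) (*-identityʳ k))
      ups : ∑[ σ < b ] ∑[ c < k ] g (up t σ c) ≡ b * k
      ups = trans (sum-cong-≗ upsAt) (∑-const b k)
      inners : ∑[ ℓ < m * k ] g (inner t ℓ) ≡ 0
      inners = ∑-zero (g ∘ inner t) λ ℓ → indicator-no _ (tVertex∉S (proj₁ (ρ (t , ℓ))))

    partner-fixpointFree : (∀ x → ρ x ≢ x) → ∀ x → partner x ≢ x
    partner-fixpointFree _      (up _ _ _)   ()
    partner-fixpointFree ρ-free (inner t ℓ)  fixed = ρ-free (t , ℓ) (inner-injective fixed)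
    partner-fixpointFree _      (down _ _ _) ()

    toCoverGraph : (2 ∣ δ → HasNoSemiEdge graph) →
      (¬ 2 ∣ δ → Σ (OneFactor graph) λ M → ∀ x → IsSemiEdge graph x → x ∈ OneFactor.darts M) →
      CoverGraph δ (b * k) k
    toCoverGraph ifEven ifOdd =
      graph , *-distribʳ-+ k (b + m) b , regular ,
      (S , independent leaveS , exactCover intoS) , ifEven , ifOdd

    coverGraph-even : 2 ∣ δ → (∀ x → ρ x ≢ x) → CoverGraph δ (b * k) k
    coverGraph-even even ρ-free =
      toCoverGraph (λ _ → noSemiEdge (partner-fixpointFree ρ-free)) (contradiction even)

    module Matching (c₀ : Fin k) (centre : Fin m → Fin (m * k))
      (ρ-centre : ∀ j → ∃[ j′ ] ρ (inj₂ j , centre j) ≡ (inj₂ j′ , centre j′))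
      (ρ-fixed : ∀ t ℓ → ρ (t , ℓ) ≡ (t , ℓ) → ∃[ j ] (t , ℓ) ≡ (inj₂ j , centre j))
      where

      Matched : Dart → Set
      Matched (up t σ c)         = t ≡ inj₁ σ × c ≡ c₀
      Matched (inner (inj₁ _) _) = ⊥
      Matched (inner (inj₂ j) ℓ) = ℓ ≡ centre j
      Matched (down σ t c)       = t ≡ inj₁ σ × c ≡ c₀

      Matched? : ∀ x → Dec (Matched x)
      Matched? (up t σ c)         = (t ≟ᵀ inj₁ σ) ×-dec (c ≟ c₀)
      Matched? (inner (inj₁ _) _) = no id
      Matched? (inner (inj₂ j) ℓ) = ℓ ≟ centre j
      Matched? (down σ t c)       = (t ≟ᵀ inj₁ σ) ×-dec (c ≟ c₀)

      partner-matched : ∀ x → Matched x → Matched (partner x)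
      partner-matched (up _ _ _)         matched = matched
      partner-matched (inner (inj₂ j) _) refl    with ρ-centre j
      ... | j′ , ρ≡ = subst (Matched ∘ uncurry inner) (sym ρ≡) refl
      partner-matched (down _ _ _)       matched = matched

      matched-loopless : ∀ x → Matched x → vertex (partner x) ≡ vertex x → partner x ≡ x
      matched-loopless (up t σ _)         _    same = contradiction (sym same) (tVertex≢sVertex t σ)
      matched-loopless (inner (inj₂ j) _) refl same with ρ-centre j
      ... | j′ , ρ≡ = trans (cong (uncurry inner) ρ≡) (cong (λ j → inner (inj₂ j) (centre j)) j′≡j)
        where
        j′≡j : j′ ≡ j
        j′≡j = inj₂-injective (tVertex-injective (inj₂ j′) (inj₂ j)
                 (trans (sym (cong (vertex ∘ uncurry inner) ρ≡)) same))
      matched-loopless (down σ t _)       _    same = contradiction same (tVertex≢sVertex t σ)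

      matched-unique : ∀ v → ∃! _≡_ λ x → vertex x ≡ v × Matched x
      matched-unique v with vertexView v
      ... | tView (inj₁ τ) = up (inj₁ τ) τ c₀ , (refl , refl , refl) , unique
        where
        unique : ∀ {y} → vertex y ≡ tVertex (inj₁ τ) × Matched y → up (inj₁ τ) τ c₀ ≡ y
        unique {up _ σ _}         (at , refl , refl) =
          cong (λ σ → up (inj₁ σ) σ c₀) (inj₁-injective (tVertex-injective (inj₁ τ) (inj₁ σ) (sym at)))
        unique {inner (inj₂ j) _} (at , _) = contradiction (tVertex-injective (inj₂ j) (inj₁ τ) at) λ ()
        unique {down σ _ _}       (at , _) = contradiction (sym at) (tVertex≢sVertex (inj₁ τ) σ)
      ... | tView (inj₂ j) = inner (inj₂ j) (centre j) , (refl , refl) , unique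
        where
        unique : ∀ {y} → vertex y ≡ tVertex (inj₂ j) × Matched y → inner (inj₂ j) (centre j) ≡ y
        unique {up _ σ _}          (at , refl , _) =
          contradiction (tVertex-injective (inj₁ σ) (inj₂ j) at) λ ()
        unique {inner (inj₂ j′) _} (at , refl)     = cong (λ j → inner (inj₂ j) (centre j))
          (inj₂-injective (tVertex-injective (inj₂ j) (inj₂ j′) (sym at)))
        unique {down σ _ _}        (at , _)        = contradiction (sym at) (tVertex≢sVertex (inj₂ j) σ)
      ... | sView σ = down σ (inj₁ σ) c₀ , (refl , refl , refl) , unique
        where
        unique : ∀ {y} → vertex y ≡ sVertex σ × Matched y → down σ (inj₁ σ) c₀ ≡ y
        unique {up t _ _}   (at , _)           = contradiction at (tVertex≢sVertex t σ)
        unique {inner t _}  (at , _)           = contradiction at (tVertex≢sVertex t σ)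
        unique {down _ _ _} (at , refl , refl) = cong (λ σ → down σ (inj₁ σ) c₀) (sVertex-injective (sym at))

      fixed⇒matched : ∀ x → partner x ≡ x → Matched x
      fixed⇒matched (inner t ℓ) fixed with ρ-fixed t ℓ (inner-injective fixed)
      ... | j , refl = refl

      coverGraph-odd : ¬ 2 ∣ δ → CoverGraph δ (b * k) k
      coverGraph-odd odd = toCoverGraph (λ even → contradiction even odd) λ _ →
        oneFactor Matched? partner-matched matched-loopless matched-unique ,
        semiEdge∈oneFactor Matched? partner-matched matched-loopless matched-unique fixed⇒matched

  reverseT : T → T
  reverseT = splitAt b ∘ opposite ∘ join b m

  reverseT-involutive : Involutive _≡_ reverseT
  reverseT-involutive t = begin
    splitAt b (opposite (join b m (splitAt b (opposite (join b m t)))))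
      ≡⟨ cong (splitAt b ∘ opposite) (join-splitAt b m _) ⟩
    splitAt b (opposite (opposite (join b m t)))
      ≡⟨ cong (splitAt b) (opposite-involutive _) ⟩
    splitAt b (join b m t)
      ≡⟨ splitAt-join b m t ⟩
    t
      ∎
    where open ≡-Reasoning

  reverseT-fixed : ∀ {t} → reverseT t ≡ t → opposite (join b m t) ≡ join b m t
  reverseT-fixed fixed = trans (sym (join-splitAt b m _)) (cong (join b m) fixed)

  private
    2-prime : Prime 2
    2-prime = from-yes (prime? 2)

  coverGraph-id : 2 ∣ δ → 2 ∣ m * k → CoverGraph δ (b * k) k
  coverGraph-id even evenInner =
    Pairing.coverGraph-even twist (twist-involutive λ _ → refl) even
      λ (_ , ℓ) fixed → even⇒opposite-fixpointFree evenInner ℓ (proj₂ (twist-fixed fixed))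
    where open Twist _≟ᵀ_ id

  coverGraph-reverseT : 2 ∣ δ → ¬ 2 ∣ m * k → CoverGraph δ (b * k) k
  coverGraph-reverseT even oddInner with euclidsLemma (b + m) k 2-prime even
  ... | inj₂ 2∣k = contradiction (∣n⇒∣m*n m 2∣k) oddInner
  ... | inj₁ 2∣a = Pairing.coverGraph-even twist (twist-involutive reverseT-involutive) even
      λ (t , _) fixed →
        even⇒opposite-fixpointFree 2∣a (join b m t) (reverseT-fixed (proj₁ (twist-fixed fixed)))
    where open Twist _≟ᵀ_ reverseT

  coverGraph-reverseM : ¬ 2 ∣ δ → 2 ∣ m * k → CoverGraph δ (b * k) k
  coverGraph-reverseM odd evenInner with euclidsLemma m k 2-prime evenInner
  ... | inj₂ 2∣k = contradiction (∣n⇒∣m*n (b + m) 2∣k) odd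
  ... | inj₁ 2∣m =
    Pairing.Matching.coverGraph-odd twist (twist-involutive (map-involutive (λ _ → refl) opposite-involutive))
      c₀ centre ρ-centre ρ-fixed odd
    where
    open Twist _≟ᵀ_ (Sum.map id opposite)
    c₀ : Fin k
    c₀ = odd⇒Fin (odd ∘ ∣n⇒∣m*n (b + m))
    -- the same slot at j and at its partner opposite j
    centre : Fin m → Fin (m * k)
    centre j = least (combine j c₀)
    ρ-centre : ∀ j → ∃[ j′ ] twist (inj₂ j , centre j) ≡ (inj₂ j′ , centre j′)
    ρ-centre j = opposite j , trans (twist-move (even⇒opposite-fixpointFree 2∣m j ∘ inj₂-injective))
                                    (cong (inj₂ (opposite j) ,_) (least-constant _ _))
    ρ-fixed : ∀ t ℓ → twist (t , ℓ) ≡ (t , ℓ) → ∃[ j ] (t , ℓ) ≡ (inj₂ j , centre j)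
    ρ-fixed t ℓ fixed = contradiction (proj₂ (twist-fixed fixed)) (even⇒opposite-fixpointFree evenInner ℓ)

  coverGraph-reverseB : ¬ 2 ∣ δ → ¬ 2 ∣ m * k → CoverGraph δ (b * k) k
  coverGraph-reverseB odd oddInner =
    Pairing.Matching.coverGraph-odd twist (twist-involutive (map-involutive opposite-involutive λ _ → refl))
      (odd⇒Fin (odd ∘ ∣n⇒∣m*n (b + m))) (λ _ → middle) ρ-centre ρ-fixed odd
    where
    open Twist _≟ᵀ_ (Sum.map opposite id)
    2∣b : 2 ∣ b
    2∣b = decidable-stable (2 ∣? b) λ oddB → odd (∣m⇒∣m*n k (odd+odd⇒even oddB (oddInner ∘ ∣m⇒∣m*n k)))
    middle : Fin (m * k)
    middle = proj₁ (odd⇒opposite-fixed oddInner)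
    middle-fixed : opposite middle ≡ middle
    middle-fixed = proj₂ (odd⇒opposite-fixed oddInner)
    ρ-centre : ∀ j → ∃[ j′ ] twist (inj₂ j , middle) ≡ (inj₂ j′ , middle)
    ρ-centre j = j , trans (twist-stay refl) (cong (inj₂ j ,_) middle-fixed)
    ρ-fixed : ∀ t ℓ → twist (t , ℓ) ≡ (t , ℓ) → ∃[ j ] (t , ℓ) ≡ (inj₂ j , middle)
    ρ-fixed (inj₁ τ) ℓ fixed =
      contradiction (inj₁-injective (proj₁ (twist-fixed fixed))) (even⇒opposite-fixpointFree 2∣b τ)
    ρ-fixed (inj₂ j) ℓ fixed =
      j , cong (inj₂ j ,_) (opposite-fixed-unique (proj₂ (twist-fixed fixed)) middle-fixed)

coverGraph : ∀ b m k → CoverGraph ((b + m) * k) (b * k) k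
coverGraph b m k with 2 ∣? (b + m) * k | 2 ∣? m * k
... | yes even | yes evenInner = Construction.coverGraph-id       b m k even evenInner
... | yes even | no  oddInner  = Construction.coverGraph-reverseT b m k even oddInner
... | no  odd  | yes evenInner = Construction.coverGraph-reverseM b m k odd  evenInner
... | no  odd  | no  oddInner  = Construction.coverGraph-reverseB b m k odd  oddInner

commonDivisor⇒CoverGraph : ∀ {d r k} .{{_ : NonZero k}} → k ∣ d → k ∣ r → r ≤ d → CoverGraph d r k
commonDivisor⇒CoverGraph {k = k} (divides a refl) (divides b refl) r≤d =
  subst (λ a → CoverGraph (a * k) (b * k) k) (m+[n∸m]≡n (*-cancelʳ-≤ b a k r≤d)) (coverGraph b (a ∸ b) k)

lemma3p2 : (d r : ℕ) → 1 ≤ d → 1 ≤ r → r ≤ d →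
    Σ GGraph λ G →
      (GGraph.nV G * gcd d r ≡ d + r) ×
      Regular G d ×
      (Σ (Subset (GGraph.nV G)) λ S → Independent G S × ExactCover G r S) ×
      (2 ∣ d → HasNoSemiEdge G) ×
      (¬ (2 ∣ d) → Σ (OneFactor G) λ M →
         ∀ x → IsSemiEdge G x → x ∈ OneFactor.darts M)
lemma3p2 d r 1≤d _ r≤d = commonDivisor⇒CoverGraph {{gcd≢0}} (gcd[m,n]∣m d r) (gcd[m,n]∣n d r) r≤d
  where
  gcd≢0 : NonZero (gcd d r)
  gcd≢0 = ≢-nonZero (gcd[m,n]≢0 d r (inj₁ (m<n⇒n≢0 1≤d)))
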